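{- Let $\phi$ be a functorial interpretation of a polygraphic program $\Pi$ which is both additive and cartesian. Then the structure differential interpretation $\partial^S_\phi$ generated by $\phi$ is strictly compatible with every structure $3$-cell of $\Pi$, i.e. $\partial^S_\phi(s_2\alpha)>\partial^S_\phi(t_2\alpha)$ pointwise for every structure $3$-cell $\alpha$.
   Context: A polygraphic program is a finite 3-polygraph with a single $0$-cell $\ast$; $k$-paths compose by $\star_j$ ($0\le j<k$), $s_j,t_j$ are $j$-source/target. Its $2$-cells split into structure $2$-cells $\tau_{\xi,\zeta}:\xi\star_0\zeta\Rightarrow\zeta\star_0\xi$, $\delta_\xi:\xi\Rightarrow\xi\star_0\xi$, $\epsilon_\xi:\xi\Rightarrow\ast$ ($\xi,\zeta$ $1$-cells), constructor $2$-cells (target a single $1$-cell) and function $2$-cells. Structure $2$-paths: $\tau_{\ast,\zeta},\tau_{\zeta,\ast},\delta_\ast,\epsilon_\ast$ are identities, $\tau_{\xi\star_0u,\zeta}=(\xi\star_0\tau_{u,\zeta})\star_1(\tau_{\xi,\zeta}\star_0u)$, $\tau_{\zeta,\xi\star_0u}=(\tau_{\zeta,\xi}\star_0u)\star_1(\xi\star_0\tau_{\zeta,u})$, $\delta_{\xi\star_0u}=(\delta_\xi\star_0\delta_u)\star_1(\xi\star_0\tau_{\xi,u}\star_0u)$, $\epsilon_{\xi\star_0u}=\epsilon_\xi\star_0\epsilon_u$. The structure $3$-cells are, for each constructor $c:u\Rightarrow\xi$ and $1$-cell $\zeta$: $(c\star_0\zeta)\star_1\tau_{\xi,\zeta}\Rrightarrow\tau_{u,\zeta}\star_1(\zeta\star_0c)$,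 $(\zeta\star_0c)\star_1\tau_{\zeta,\xi}\Rrightarrow\tau_{\zeta,u}\star_1(c\star_0\zeta)$, $c\star_1\delta_\xi\Rrightarrow\delta_u\star_1(c\star_0c)$, $c\star_1\epsilon_\xi\Rrightarrow\epsilon_u$. A functorial interpretation $\phi$ assigns to each $1$-path $u$ with $n$ $1$-cells a nonempty $\phi(u)\subseteq(\mathbb{N}\setminus\{0\})^n$ and to each $2$-path $f:u\Rightarrow v$ a monotone $\phi(f):\phi(u)\to\phi(v)$, with $\phi(u\star_0v)=\phi(u)\times\phi(v)$, $\phi(f\star_0g)=\phi(f)\times\phi(g)$, $\phi(f\star_1g)=\phi(g)\circ\phi(f)$, identities to identities. Additive: each constructor $c$ of arity $n$ has an integer $c_c\ge1$ with $\phi(c)(x)=x_1+\dots+x_n+c_c$. Cartesian: $\phi(\delta_\xi)(x)=(x,x)$ and $\phi(\tau_{\xi,\zeta})(x,y)=(y,x)$. The structure differential interpretation $\partial^S_\phi$ assigns to each $2$-path $f$ a map $\partial^S_\phi f:\phi(s_1f)\to\mathbb{N}$ determined by $\partial^S_\phi(\text{identity})=0$, $\partial^S_\phi(f\star_0g)(x,y)=\partial^S_\phi f(x)+\partial^S_\phi g(y)$, $\partial^S_\phi(f\star_1g)=\partial^S_\phi f+\partial^S_\phi g\circ\phi(f)$, with value $0$ on constructor and function $2$-cells and $\partial^S_\phi\tau(x,y)=xy$, $\partial^S_\phi\delta(x)=x^2$, $\partial^S_\phi\epsilon(x)=x$. -}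

module Defs where

open import Data.Nat using (ℕ; zero; suc; _+_; _*_; _≤_; _<_)
open import Data.Fin using (Fin)
open import Data.List using (List; []; _∷_; _++_)
open import Data.List.Properties using (++-assoc)
open import Data.Product using (Σ; _×_; _,_; proj₁; proj₂)
open import Data.Unit using (⊤; tt)
open import Relation.Binary.PropositionalEquality using (_≡_; refl; subst; cong)

-- The 1- and 2-cells of a (finite) polygraphic program with one 0-cell.
-- 1-cells: Fin n₁.  1-paths: lists of 1-cells ([] is the identity on ∗,
-- ⋆₀ on 1-paths is _++_).  Constructor 2-cells: Fin nc, with source
-- 1-path cin c and target the single 1-cell cout c.  Function 2-cells:
-- Fin nf.  Structure 2-cells τ, δ, ε are built into the syntax of 2-paths.

record Signature : Set where
  field
    n₁ nc nf : ℕ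
    cin  : Fin nc → List (Fin n₁)
    cout : Fin nc → Fin n₁
    fin  : Fin nf → List (Fin n₁)
    fout : Fin nf → List (Fin n₁)

Path1 : Signature → Set
Path1 S = List (Fin (Signature.n₁ S))

data Path2 (S : Signature) : Path1 S → Path1 S → Set where
  τ   : (ξ ζ : Fin (Signature.n₁ S)) → Path2 S (ξ ∷ ζ ∷ []) (ζ ∷ ξ ∷ [])
  δ   : (ξ : Fin (Signature.n₁ S)) → Path2 S (ξ ∷ []) (ξ ∷ ξ ∷ [])
  ε   : (ξ : Fin (Signature.n₁ S)) → Path2 S (ξ ∷ []) []
  con : (c : Fin (Signature.nc S)) →
        Path2 S (Signature.cin S c) (Signature.cout S c ∷ [])
  fun : (f : Fin (Signature.nf S)) →
        Path2 S (Signature.fin S f) (Signature.fout S f)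
  idp : (u : Path1 S) → Path2 S u u
  _⋆₀_ : ∀ {u v u' v'} → Path2 S u v → Path2 S u' v' → Path2 S (u ++ u') (v ++ v')
  _⋆₁_ : ∀ {u v w} → Path2 S u v → Path2 S v w → Path2 S u w

infixl 7 _⋆₀_
infixl 6 _⋆₁_

module _ {S : Signature} where
  open Signature S

  τL : (u : Path1 S) (ζ : Fin n₁) → Path2 S (u ++ ζ ∷ []) (ζ ∷ u)
  τL [] ζ = idp (ζ ∷ [])
  τL (ξ ∷ u) ζ = (idp (ξ ∷ []) ⋆₀ τL u ζ) ⋆₁ (τ ξ ζ ⋆₀ idp u)

  τR : (ζ : Fin n₁) (u : Path1 S) → Path2 S (ζ ∷ u) (u ++ ζ ∷ [])
  τR ζ [] = idp (ζ ∷ [])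
  τR ζ (ξ ∷ u) = (τ ζ ξ ⋆₀ idp u) ⋆₁ (idp (ξ ∷ []) ⋆₀ τR ζ u)

  -- δ_u : u ⇒ u ⋆₀ u   (the final transport is the associativity of ⋆₀)
  δL : (u : Path1 S) → Path2 S u (u ++ u)
  δL [] = idp []
  δL (ξ ∷ u) =
    (δ ξ ⋆₀ δL u) ⋆₁
    subst (Path2 S (ξ ∷ ξ ∷ (u ++ u))) (cong (ξ ∷_) (++-assoc u (ξ ∷ []) u))
          (idp (ξ ∷ []) ⋆₀ (τR ξ u ⋆₀ idp u))

  εL : (u : Path1 S) → Path2 S u []
  εL [] = idp []
  εL (ξ ∷ u) = ε ξ ⋆₀ εL u

record Cell3 (S : Signature) : Set where
  field
    {s₁ t₁} : Path1 S
    src tgt : Path2 S s₁ t₁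
open Cell3 public

data StructCell3 (S : Signature) : Set where
  τ-left  : Fin (Signature.nc S) → Fin (Signature.n₁ S) → StructCell3 S
  τ-right : Fin (Signature.nc S) → Fin (Signature.n₁ S) → StructCell3 S
  δ-cell  : Fin (Signature.nc S) → StructCell3 S
  ε-cell  : Fin (Signature.nc S) → StructCell3 S

structure : {S : Signature} → StructCell3 S → Cell3 S
structure {S} (τ-left c ζ) = record
  { src = (con c ⋆₀ idp (ζ ∷ [])) ⋆₁ τ (Signature.cout S c) ζ
  ; tgt = τL (Signature.cin S c) ζ ⋆₁ (idp (ζ ∷ []) ⋆₀ con c) }
structure {S} (τ-right c ζ) = record
  { src = (idp (ζ ∷ []) ⋆₀ con c) ⋆₁ τ ζ (Signature.cout S c)
  ; tgt = τR ζ (Signature.cin S c) ⋆₁ (con c ⋆₀ idp (ζ ∷ [])) }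
structure {S} (δ-cell c) = record
  { src = con c ⋆₁ δ (Signature.cout S c)
  ; tgt = δL (Signature.cin S c) ⋆₁ (con c ⋆₀ con c) }
structure {S} (ε-cell c) = record
  { src = con c ⋆₁ ε (Signature.cout S c)
  ; tgt = εL (Signature.cin S c) }

-- A polygraphic program: its 2-dimensional part plus its (computation)
-- 3-cells; the structure 3-cells are given by 'structure' above.
record Program : Set where
  field
    sig   : Signature
    rules : List (Cell3 sig)

-- Functorial interpretations.
-- φ(ξ) for a 1-cell ξ is the subset {n | P ξ n} of ℕ∖{0}; φ(u) for a
-- 1-path u is the product of the φ(ξ) (φ(u ⋆₀ v) = φ(u) × φ(v)).

El : ∀ {n} → (Fin n → ℕ → Set) → List (Fin n) → Set
El P [] = ⊤
El P (ξ ∷ u) = Σ ℕ (P ξ) × El P u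

LeE : ∀ {n} (P : Fin n → ℕ → Set) (u : List (Fin n)) → El P u → El P u → Set
LeE P [] _ _ = ⊤
LeE P (ξ ∷ u) (a , x) (b , y) = proj₁ a ≤ proj₁ b × LeE P u x y

Monotone : ∀ {n} (P : Fin n → ℕ → Set) (u v : List (Fin n)) → (El P u → El P v) → Set
Monotone P u v F = ∀ x y → LeE P u x y → LeE P v (F x) (F y)

split : ∀ {n} (P : Fin n → ℕ → Set) (u v : List (Fin n)) → El P (u ++ v) → El P u × El P v
split P [] v x = tt , x
split P (ξ ∷ u) v (a , x) = (a , proj₁ (split P u v x)) , proj₂ (split P u v x)

append : ∀ {n} (P : Fin n → ℕ → Set) (u v : List (Fin n)) → El P u → El P v → El P (u ++ v)
append P [] v tt y = y
append P (ξ ∷ u) v (a , x) y = a , append P u v x y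

sumEl : ∀ {n} {P : Fin n → ℕ → Set} (u : List (Fin n)) → El P u → ℕ
sumEl [] _ = 0
sumEl (ξ ∷ u) (a , x) = proj₁ a + sumEl u x

-- Values of φ on the generating 2-cells (φ(ε_ξ) : φ(ξ) → φ(∗) = {()} is
-- forced), with monotonicity; φ on all 2-paths is the functorial extension.
record Interp (S : Signature) : Set₁ where
  field
    P          : Fin (Signature.n₁ S) → ℕ → Set
    P-pos      : ∀ ξ n → P ξ n → 0 < n
    P-nonempty : ∀ ξ → Σ ℕ (P ξ)
    φτ : ∀ ξ ζ → El P (ξ ∷ ζ ∷ []) → El P (ζ ∷ ξ ∷ [])
    φδ : ∀ ξ → El P (ξ ∷ []) → El P (ξ ∷ ξ ∷ [])
    φc : ∀ c → El P (Signature.cin S c) → El P (Signature.cout S c ∷ [])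
    φf : ∀ f → El P (Signature.fin S f) → El P (Signature.fout S f)
    mono-τ : ∀ ξ ζ → Monotone P (ξ ∷ ζ ∷ []) (ζ ∷ ξ ∷ []) (φτ ξ ζ)
    mono-δ : ∀ ξ → Monotone P (ξ ∷ []) (ξ ∷ ξ ∷ []) (φδ ξ)
    mono-c : ∀ c → Monotone P (Signature.cin S c) (Signature.cout S c ∷ []) (φc c)
    mono-f : ∀ f → Monotone P (Signature.fin S f) (Signature.fout S f) (φf f)

module _ {S : Signature} (φ : Interp S) where
  open Interp φ

  ⟦_⟧ : ∀ {u v} → Path2 S u v → El P u → El P v
  ⟦ τ ξ ζ ⟧ x = φτ ξ ζ x
  ⟦ δ ξ ⟧ x = φδ ξ x
  ⟦ ε ξ ⟧ x = tt
  ⟦ con c ⟧ x = φc c x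
  ⟦ fun f ⟧ x = φf f x
  ⟦ idp u ⟧ x = x
  ⟦ _⋆₀_ {u} {v} {u'} {v'} f g ⟧ x =
    append P v v' (⟦ f ⟧ (proj₁ (split P u u' x))) (⟦ g ⟧ (proj₂ (split P u u' x)))
  ⟦ f ⋆₁ g ⟧ x = ⟦ g ⟧ (⟦ f ⟧ x)

  ∂S : ∀ {u v} → Path2 S u v → El P u → ℕ
  ∂S (τ ξ ζ) (a , b , tt) = proj₁ a * proj₁ b
  ∂S (δ ξ) (a , tt) = proj₁ a * proj₁ a
  ∂S (ε ξ) (a , tt) = proj₁ a
  ∂S (con c) x = 0
  ∂S (fun f) x = 0
  ∂S (idp u) x = 0
  ∂S (_⋆₀_ {u} {v} {u'} {v'} f g) x =
    ∂S f (proj₁ (split P u u' x)) + ∂S g (proj₂ (split P u u' x))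
  ∂S (f ⋆₁ g) x = ∂S f x + ∂S g (⟦ f ⟧ x)

  Additive : Set
  Additive = ∀ c → Σ ℕ λ k → 1 ≤ k ×
    (∀ x → proj₁ (proj₁ (φc c x)) ≡ sumEl (Signature.cin S c) x + k)

  Cartesian : Set
  Cartesian = (∀ ξ a → φδ ξ (a , tt) ≡ (a , a , tt))
            × (∀ ξ ζ a b → φτ ξ ζ (a , b , tt) ≡ (b , a , tt))

  StrictlyCompatible : Cell3 S → Set
  StrictlyCompatible α = ∀ x → ∂S (tgt α) x < ∂S (src α) x

{-# OPTIONS --safe #-}
-- Under a cartesian φ the structure 2-paths only permute, duplicate or erase
-- arguments, and their ∂ is computed by induction on the 1-path u:
-- ∂τ_{u,ζ}(x, b) = (Σx)·b, ∂τ_{ζ,u}(b, x) = b·Σx, ∂δ_u(x) ≤ (Σx)² and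
-- ∂ε_u(x) = Σx.  The source of each structure 3-cell pays the same price on
-- the single value φ(c)(x) instead, and additivity gives φ(c)(x) > Σx; as
-- all values are positive, the products stay strictly larger.
module Submission where

open import Defs
open import Data.Nat using (ℕ; _+_; _*_; _≤_; _<_; >-nonZero)
open import Data.Nat.Properties
open import Data.Nat.Tactic.RingSolver using (solve-∀)
open import Data.Fin using (Fin)
open import Data.List using ([]; _∷_; _++_)
open import Data.List.Properties using (++-assoc)
open import Data.Product using (_,_; proj₁; proj₂)
open import Data.Unit using (tt)
open import Function using (_∘_)
open import Relation.Binary.PropositionalEquality
open import Relation.Binary.PropositionalEquality.Properties using (subst-∘; subst-application′)

module _ {n : ℕ} {P : Fin n → ℕ → Set} where

  split-append : ∀ u v (x : El P u) (y : El P v) → split P u v (append P u v x y) ≡ (x , y)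
  split-append []      v tt      y = refl
  split-append (ξ ∷ u) v (a , x) y = cong (λ (x′ , y′) → (a , x′) , y′) (split-append u v x y)

  append-split : ∀ u v (z : El P (u ++ v)) →
                 append P u v (proj₁ (split P u v z)) (proj₂ (split P u v z)) ≡ z
  append-split []      v z       = refl
  append-split (ξ ∷ u) v (a , z) = cong (a ,_) (append-split u v z)

  El-++-elim : ∀ u v {Q : El P (u ++ v) → Set} →
               (∀ x y → Q (append P u v x y)) → ∀ z → Q z
  El-++-elim u v {Q} h z = subst Q (append-split u v z) (h _ _)

  append-assoc : ∀ u v w (x : El P u) (y : El P v) (z : El P w) →
                 subst (El P) (++-assoc u v w) (append P (u ++ v) w (append P u v x y) z)
                   ≡ append P u (v ++ w) x (append P v w y z)
  append-assoc []      v w tt      y z = refl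
  append-assoc (ξ ∷ u) v w (a , x) y z = begin
    subst (El P) (cong (ξ ∷_) (++-assoc u v w)) (a , append P (u ++ v) w (append P u v x y) z)
      ≡⟨ sym (subst-∘ (++-assoc u v w)) ⟩
    subst (El P ∘ (ξ ∷_)) (++-assoc u v w) (a , append P (u ++ v) w (append P u v x y) z)
      ≡⟨ subst-application′ (El P) (λ _ → a ,_) (++-assoc u v w) ⟩
    a , subst (El P) (++-assoc u v w) (append P (u ++ v) w (append P u v x y) z)
      ≡⟨ cong (a ,_) (append-assoc u v w x y z) ⟩
    a , append P u (v ++ w) x (append P v w y z) ∎
    where open ≡-Reasoning

module _ {S : Signature} (φ : Interp S) where
  open Signature S
  open Interp φ

  ⟦⋆₀⟧-append : ∀ {u v u′ v′} (f : Path2 S u v) (g : Path2 S u′ v′) x y →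
                ⟦_⟧ φ (f ⋆₀ g) (append P u u′ x y) ≡ append P v v′ (⟦_⟧ φ f x) (⟦_⟧ φ g y)
  ⟦⋆₀⟧-append {u} {v} {u′} {v′} f g x y =
    cong (λ (x′ , y′) → append P v v′ (⟦_⟧ φ f x′) (⟦_⟧ φ g y′)) (split-append u u′ x y)

  ∂S-⋆₀-append : ∀ {u v u′ v′} (f : Path2 S u v) (g : Path2 S u′ v′) x y →
                 ∂S φ (f ⋆₀ g) (append P u u′ x y) ≡ ∂S φ f x + ∂S φ g y
  ∂S-⋆₀-append {u} {u′ = u′} f g x y =
    cong (λ (x′ , y′) → ∂S φ f x′ + ∂S φ g y′) (split-append u u′ x y)

  ⟦subst⟧ : ∀ {w v v′} (eq : v ≡ v′) (p : Path2 S w v) x →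
            ⟦_⟧ φ (subst (Path2 S w) eq p) x ≡ subst (El P) eq (⟦_⟧ φ p x)
  ⟦subst⟧ refl p x = refl

  ∂S-subst : ∀ {w v v′} (eq : v ≡ v′) (p : Path2 S w v) x →
             ∂S φ (subst (Path2 S w) eq p) x ≡ ∂S φ p x
  ∂S-subst refl p x = refl

  ∂S-εL : ∀ u x → ∂S φ (εL u) x ≡ sumEl u x
  ∂S-εL []      tt      = refl
  ∂S-εL (ξ ∷ u) (a , x) = cong (proj₁ a +_) (∂S-εL u x)

  δL-reassoc : ∀ (ξ : Fin n₁) (u : Path1 S) → ξ ∷ ((u ++ ξ ∷ []) ++ u) ≡ ξ ∷ (u ++ ξ ∷ u)
  δL-reassoc ξ u = cong (ξ ∷_) (++-assoc u (ξ ∷ []) u)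

  δL-interleave : ∀ ξ (u : Path1 S) → Path2 S (ξ ∷ ξ ∷ (u ++ u)) (ξ ∷ ((u ++ ξ ∷ []) ++ u))
  δL-interleave ξ u = idp (ξ ∷ []) ⋆₀ (τR ξ u ⋆₀ idp u)

  -- δL (ξ ∷ u) is definitionally (δ ξ ⋆₀ δL u) ⋆₁ δL-step ξ u.
  δL-step : ∀ ξ (u : Path1 S) → Path2 S (ξ ∷ ξ ∷ (u ++ u)) (ξ ∷ (u ++ ξ ∷ u))
  δL-step ξ u = subst (Path2 S _) (δL-reassoc ξ u) (δL-interleave ξ u)

  ExceedsSum : Fin nc → Set
  ExceedsSum c = ∀ x → sumEl (cin c) x < proj₁ (proj₁ (φc c x))

  additive⇒exceedsSum : Additive φ → ∀ c → ExceedsSum c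
  additive⇒exceedsSum add c x =
    let (k , 1≤k , φc≡) = add c in subst (sumEl (cin c) x <_) (sym (φc≡ x)) (m<m+n _ 1≤k)

  ε-compatible : ∀ {c} → ExceedsSum c → StrictlyCompatible φ (structure (ε-cell c))
  ε-compatible {c} exceeds x = begin-strict
    ∂S φ (εL (cin c)) x         ≡⟨ ∂S-εL (cin c) x ⟩
    sumEl (cin c) x             <⟨ exceeds x ⟩
    proj₁ (proj₁ (φc c x))      ∎
    where open ≤-Reasoning

  module _ (cart : Cartesian φ) where

    ⟦τL⟧ : ∀ u ζ x b → ⟦_⟧ φ (τL u ζ) (append P u (ζ ∷ []) x (b , tt)) ≡ (b , x)
    ⟦τL⟧ []      ζ tt      b = refl
    ⟦τL⟧ (ξ ∷ u) ζ (a , x) b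
      rewrite ⟦τL⟧ u ζ x b = cong (λ (b′ , a′ , _) → b′ , a′ , x) (proj₂ cart ξ ζ a b)

    ∂S-τL : ∀ u ζ x b → ∂S φ (τL u ζ) (append P u (ζ ∷ []) x (b , tt)) ≡ sumEl u x * proj₁ b
    ∂S-τL []      ζ tt      b = refl
    ∂S-τL (ξ ∷ u) ζ (a , x) b
      rewrite ⟦τL⟧ u ζ x b | ∂S-τL u ζ x b = distrib (proj₁ a) (sumEl u x) (proj₁ b)
      where
      distrib : ∀ a s b → s * b + (a * b + 0) ≡ (a + s) * b
      distrib = solve-∀

    ⟦τR⟧ : ∀ ζ u b y → ⟦_⟧ φ (τR ζ u) (b , y) ≡ append P u (ζ ∷ []) y (b , tt)
    ⟦τR⟧ ζ []      b tt      = refl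
    ⟦τR⟧ ζ (ξ ∷ u) b (a , y)
      rewrite proj₂ cart ζ ξ b a = cong (a ,_) (⟦τR⟧ ζ u b y)

    ∂S-τR : ∀ ζ u b y → ∂S φ (τR ζ u) (b , y) ≡ proj₁ b * sumEl u y
    ∂S-τR ζ []      b tt      = sym (*-zeroʳ (proj₁ b))
    ∂S-τR ζ (ξ ∷ u) b (a , y)
      rewrite proj₂ cart ζ ξ b a | ∂S-τR ζ u b y = distrib (proj₁ b) (proj₁ a) (sumEl u y)
      where
      distrib : ∀ b a s → b * a + 0 + b * s ≡ b * (a + s)
      distrib = solve-∀

    ⟦δL-step⟧ : ∀ ξ u a y → ⟦_⟧ φ (δL-step ξ u) (a , a , append P u u y y)
                             ≡ (a , append P u (ξ ∷ u) y (a , y))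
    ⟦δL-step⟧ ξ u a y = begin
      ⟦_⟧ φ (δL-step ξ u) (a , a , append P u u y y)
        ≡⟨ ⟦subst⟧ (δL-reassoc ξ u) (δL-interleave ξ u) (a , a , append P u u y y) ⟩
      subst (El P) (δL-reassoc ξ u) (a , ⟦_⟧ φ (τR ξ u ⋆₀ idp u) (append P (ξ ∷ u) u (a , y) y))
        ≡⟨ cong (subst (El P) (δL-reassoc ξ u) ∘ (a ,_)) (⟦⋆₀⟧-append (τR ξ u) (idp u) (a , y) y) ⟩
      subst (El P) (δL-reassoc ξ u) (a , append P (u ++ ξ ∷ []) u (⟦_⟧ φ (τR ξ u) (a , y)) y)
        ≡⟨ cong (λ z → subst (El P) (δL-reassoc ξ u) (a , append P (u ++ ξ ∷ []) u z y)) (⟦τR⟧ ξ u a y) ⟩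
      subst (El P) (δL-reassoc ξ u) (a , append P (u ++ ξ ∷ []) u (append P u (ξ ∷ []) y (a , tt)) y)
        ≡⟨ append-assoc (ξ ∷ u) (ξ ∷ []) u (a , y) (a , tt) y ⟩
      a , append P u (ξ ∷ u) y (a , y) ∎
      where open ≡-Reasoning

    ∂S-δL-step : ∀ ξ u a y → ∂S φ (δL-step ξ u) (a , a , append P u u y y) ≡ proj₁ a * sumEl u y
    ∂S-δL-step ξ u a y = begin
      ∂S φ (δL-step ξ u) (a , a , append P u u y y)
        ≡⟨ ∂S-subst (δL-reassoc ξ u) (δL-interleave ξ u) (a , a , append P u u y y) ⟩
      ∂S φ (τR ξ u ⋆₀ idp u) (append P (ξ ∷ u) u (a , y) y)
        ≡⟨ ∂S-⋆₀-append (τR ξ u) (idp u) (a , y) y ⟩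
      ∂S φ (τR ξ u) (a , y) + 0
        ≡⟨ +-identityʳ _ ⟩
      ∂S φ (τR ξ u) (a , y)
        ≡⟨ ∂S-τR ξ u a y ⟩
      proj₁ a * sumEl u y ∎
      where open ≡-Reasoning

    ⟦δL⟧ : ∀ u y → ⟦_⟧ φ (δL u) y ≡ append P u u y y
    ⟦δL⟧ []      tt      = refl
    ⟦δL⟧ (ξ ∷ u) (a , y) rewrite proj₁ cart ξ a | ⟦δL⟧ u y = ⟦δL-step⟧ ξ u a y

    ∂S-δL-≤ : ∀ u y → ∂S φ (δL u) y ≤ sumEl u y * sumEl u y
    ∂S-δL-≤ []      tt      = ≤-refl
    ∂S-δL-≤ (ξ ∷ u) (a , y)
      rewrite proj₁ cart ξ a | ⟦δL⟧ u y = begin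
        proj₁ a * proj₁ a + ∂S φ (δL u) y + ∂S φ (δL-step ξ u) (a , a , append P u u y y)
          ≡⟨ cong (proj₁ a * proj₁ a + ∂S φ (δL u) y +_) (∂S-δL-step ξ u a y) ⟩
        proj₁ a * proj₁ a + ∂S φ (δL u) y + proj₁ a * sumEl u y
          ≤⟨ +-monoˡ-≤ _ (+-monoʳ-≤ (proj₁ a * proj₁ a) (∂S-δL-≤ u y)) ⟩
        proj₁ a * proj₁ a + sumEl u y * sumEl u y + proj₁ a * sumEl u y
          ≤⟨ m≤m+n _ (sumEl u y * proj₁ a) ⟩
        proj₁ a * proj₁ a + sumEl u y * sumEl u y + proj₁ a * sumEl u y + sumEl u y * proj₁ a
          ≡⟨ square-of-sum (proj₁ a) (sumEl u y) ⟩
        (proj₁ a + sumEl u y) * (proj₁ a + sumEl u y) ∎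
      where
      open ≤-Reasoning
      square-of-sum : ∀ a s → a * a + s * s + a * s + s * a ≡ (a + s) * (a + s)
      square-of-sum = solve-∀

    module _ {c : Fin nc} (exceeds : ExceedsSum c) where
      open ≤-Reasoning

      τ-left-compatible : ∀ ζ → StrictlyCompatible φ (structure (τ-left c ζ))
      τ-left-compatible ζ = El-++-elim (cin c) (ζ ∷ []) λ x (b , tt) → begin-strict
        ∂S φ (τL (cin c) ζ) (append P (cin c) (ζ ∷ []) x (b , tt)) + 0
          ≡⟨ +-identityʳ _ ⟩
        ∂S φ (τL (cin c) ζ) (append P (cin c) (ζ ∷ []) x (b , tt))
          ≡⟨ ∂S-τL (cin c) ζ x b ⟩
        sumEl (cin c) x * proj₁ b
          <⟨ *-monoˡ-< (proj₁ b) {{>-nonZero (P-pos ζ _ (proj₂ b))}} (exceeds x) ⟩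
        proj₁ (proj₁ (φc c x)) * proj₁ b
          ≡⟨ cong (∂S φ (τ (cout c) ζ)) (⟦⋆₀⟧-append (con c) (idp (ζ ∷ [])) x (b , tt)) ⟨
        ∂S φ (τ (cout c) ζ) (⟦_⟧ φ (con c ⋆₀ idp (ζ ∷ [])) (append P (cin c) (ζ ∷ []) x (b , tt))) ∎

      τ-right-compatible : ∀ ζ → StrictlyCompatible φ (structure (τ-right c ζ))
      τ-right-compatible ζ (b , y) = begin-strict
        ∂S φ (τR ζ (cin c)) (b , y) + 0  ≡⟨ +-identityʳ _ ⟩
        ∂S φ (τR ζ (cin c)) (b , y)      ≡⟨ ∂S-τR ζ (cin c) b y ⟩
        proj₁ b * sumEl (cin c) y        <⟨ *-monoʳ-< (proj₁ b) {{>-nonZero (P-pos ζ _ (proj₂ b))}} (exceeds y) ⟩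
        proj₁ b * proj₁ (proj₁ (φc c y)) ∎

      δ-compatible : StrictlyCompatible φ (structure (δ-cell c))
      δ-compatible x = begin-strict
        ∂S φ (δL (cin c)) x + 0           ≡⟨ +-identityʳ _ ⟩
        ∂S φ (δL (cin c)) x               ≤⟨ ∂S-δL-≤ (cin c) x ⟩
        sumEl (cin c) x * sumEl (cin c) x <⟨ *-mono-< (exceeds x) (exceeds x) ⟩
        proj₁ (proj₁ (φc c x)) * proj₁ (proj₁ (φc c x)) ∎

lemma3p13 : (Π : Program) (φ : Interp (Program.sig Π)) →
    Additive φ → Cartesian φ →
    (α : StructCell3 (Program.sig Π)) → StrictlyCompatible φ (structure α)
lemma3p13 Π φ add cart (τ-left c ζ)  = τ-left-compatible φ cart (additive⇒exceedsSum φ add c) ζ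
lemma3p13 Π φ add cart (τ-right c ζ) = τ-right-compatible φ cart (additive⇒exceedsSum φ add c) ζ
lemma3p13 Π φ add cart (δ-cell c)    = δ-compatible φ cart (additive⇒exceedsSum φ add c)
lemma3p13 Π φ add cart (ε-cell c)    = ε-compatible φ (additive⇒exceedsSum φ add c)
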